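{- Let $n \ge 1$ be an integer, let $\mathcal{F}$ be the set of all partial orders on $[n]=\{1,\dots,n\}$, and let $\mathcal{G}\subseteq\mathcal{F}$ be the set of all total orders on $[n]$. Regard $\mathcal{F}$ as a family of subsets of the ground set $\mathcal{G}$ by identifying each $A\in\mathcal{F}$ with the set $\{B\in\mathcal{G} : B \text{ is compatible with } A\}$. Then the VC-dimension $\mathrm{VC}_{\mathcal{G}}(\mathcal{F})$ of this set family satisfies \[ \mathrm{VC}_{\mathcal{G}}(\mathcal{F}) = \begin{cases} 3, & n=3,\\ \left\lfloor \frac{n^2}{4}\right\rfloor, & n\neq 3.\end{cases} \]
   Context: Two partial orders $<_1,<_2$ on $[n]$ are called compatible if there exists a partial order on $[n]$ finer than both (i.e. containing both relations), equivalently if the directed graph on $[n]$ whose edge set is $<_1\cup<_2$ (an edge $a\to b$ whenever $a<_1 b$ or $a<_2 b$) is acyclic. The empty relation counts as a partial order. For a family $\mathcal{H}$ of subsets of a set $X$, a subset $S\subseteq X$ is shattered by $\mathcal{H}$ if for every $A\subseteq S$ there is $B\in\mathcal{H}$ with $B\cap S=A$; the VC-dimension of $\mathcal{H}$ on $X$ is the largest cardinality of a subset of $X$ shattered by $\mathcal{H}$. Here $\mathrm{VC}_{\mathcal{G}}(\mathcal{F})$ denotes the VC-dimension of the family $\{\{B\in\mathcal{G}: B \text{ compatible with } A\} : A\in\mathcal{F}\}$ on the ground set $\mathcal{G}$. -}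

module Defs where

open import Data.Nat using (ℕ; _*_)
open import Data.Nat.DivMod using (_/_)
open import Data.Fin using (Fin)
open import Data.Bool using (Bool; true; false)
open import Data.Product using (Σ; _×_; ∃)
open import Data.Sum using (_⊎_)
open import Relation.Nullary using (¬_)
open import Relation.Binary.PropositionalEquality using (_≡_)
open import Function.Bundles using (_⇔_)

BRel : ℕ → Set
BRel n = Fin n → Fin n → Bool

IsPartialOrder : ∀ {n} → BRel n → Set
IsPartialOrder {n} R =
  ((a : Fin n) → R a a ≡ false) ×
  ((a b c : Fin n) → R a b ≡ true → R b c ≡ true → R a c ≡ true)

IsTotalOrder : ∀ {n} → BRel n → Set
IsTotalOrder {n} R =
  IsPartialOrder R × ((a b : Fin n) → ¬ (a ≡ b) → (R a b ≡ true) ⊎ (R b a ≡ true))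

_⊆ᴿ_ : ∀ {n} → BRel n → BRel n → Set
_⊆ᴿ_ {n} R T = (a b : Fin n) → R a b ≡ true → T a b ≡ true

Compatible : ∀ {n} → BRel n → BRel n → Set
Compatible {n} R S = ∃ λ (T : BRel n) → IsPartialOrder T × (R ⊆ᴿ T) × (S ⊆ᴿ T)

-- A finite subset of the ground set G (total orders on [n]) of cardinality k,
-- given as an injective enumeration Fin k → total orders.
record TotalOrderSet (n k : ℕ) : Set where
  field
    elem     : Fin k → BRel n
    total    : (i : Fin k) → IsTotalOrder (elem i)
    distinct : (i j : Fin k) → ((a b : Fin n) → elem i a b ≡ elem j a b) → i ≡ j

open TotalOrderSet public

Shattered : ∀ {n k} → TotalOrderSet n k → Set
Shattered {n} {k} S =
  (X : Fin k → Bool) →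
  ∃ λ (A : BRel n) → IsPartialOrder A ×
    ((i : Fin k) → Compatible (elem S i) A ⇔ (X i ≡ true))

vcValue : ℕ → ℕ
vcValue 3 = 3
vcValue n = (n * n) / 4

{-# OPTIONS --safe #-}
module Submission where

-- If k ≥ 4 total orders B₁, …, B_k are shattered, realising the labelling
-- "all but i" gives a partial order contained in every B_j (j ≠ i) but not in B_i, hence a pair
-- (x_i, y_i) that B_i alone puts in the order y_i < x_i. The pairs {x_i, y_i} are the edges of a
-- simple triangle-free graph on [n]: a transitive triangle is refuted by the order reversing its
-- long edge, a cyclic one by any fourth order. Mantel's theorem gives k ≤ n²/4. For k ≤ 3 only
-- n ≤ 2 matters, where the empty labelling cannot be realised.
--
-- Split [n] into p = ⌊n/2⌋ lows and q = ⌈n/2⌉ highs, and for a low L and a high R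
-- let B_LR list the lows other than L, then R, then L, then the highs other than R. Every low-high
-- pair except (L, R) is ordered low first, so a labelling is realised by the bipartite order
-- putting l below h for the unselected pairs (l, h). This shatters pq = ⌊n²/4⌋ orders; for n = 3
-- the three cyclic rotations of [3] are shattered, which is checked by evaluation.

open import Defs
open import Data.Nat using (ℕ; _≤_)
open import Data.Product using (_×_; Σ; ∃)

open import Data.Bool.Base using (Bool; true; false; not; _∧_; _∨_; if_then_else_)
open import Data.Bool.Properties using (not-¬; not-injective) renaming (_≟_ to _≟ᵇ_)
open import Data.Empty using (⊥; ⊥-elim)
open import Data.Fin.Base as Fin using (Fin; zero; suc; toℕ; splitAt; _↑ˡ_; _↑ʳ_; combine; remQuot)
open import Data.Fin.Patterns using (0F; 1F; 2F; 3F)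
open import Data.Fin.Properties
  using (_≟_; all?; ¬∀⟶∃¬; suc-injective; 0≢1+n; injective⇒≤; toℕ-injective;
         combine-injectiveʳ; combine-monoˡ-<; combine-remQuot; splitAt-↑ˡ; splitAt-↑ʳ)
open import Data.List.Base using (List; []; _∷_; length; lookup)
open import Data.List.Membership.Propositional using (_∈_; _∉_)
open import Data.List.Relation.Unary.Any using (here; there; index; any?)
open import Data.List.Relation.Unary.Any.Properties using (lookup-index)
open import Data.Nat.Base using (zero; suc; _+_; _*_; _<_; z≤n; s≤s; z<s; ⌊_/2⌋; ⌈_/2⌉)
open import Data.Nat.DivMod using (_/_; _%_; /-congˡ; /-monoˡ-≤; m*n/n≡m; +-distrib-/-∣ʳ)
open import Data.Nat.Divisibility using (divides)
open import Data.Nat.Properties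
  using (≤-refl; ≤-trans; ≤-reflexive; ≤-total; ≤-pred; ≰⇒>; <⇒≱; ≮⇒≥; n≤0⇒n≡0; <-trans; <-asym; <-cmp; n≮n;
         +-comm; +-identityʳ; +-mono-≤; m≤m+n; m≤n⇒∃[o]m+o≡n; *-comm; *-assoc; *-identityʳ; *-distribˡ-+;
         *-mono-≤; *-monoʳ-≤; *-cancelˡ-≤; *-cancelʳ-≤; ⌊n/2⌋+⌈n/2⌉≡n; +-*-semiring; module ≤-Reasoning)
  renaming (_<?_ to _<ℕ?_; _≤?_ to _≤ℕ?_)
open import Algebra.Properties.Semiring.Sum +-*-semiring
  using (sum; sum-syntax; sum-cong-≗; sum-replicate-zero; ∑-distrib-+; ∑-comm; *-distribˡ-sum; *-distribʳ-sum)
open import Data.Nat.Tactic.RingSolver using (solve-∀)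
open import Data.Product using (_,_; proj₁; proj₂; ∃₂; uncurry)
open import Data.Sum.Base using (_⊎_; inj₁; inj₂)
open import Data.Vec.Base using (Vec; _∷_; []; tabulate) renaming (lookup to lookupᵛ)
open import Data.Vec.Properties using (lookup∘tabulate)
open import Function.Base using (_∘_; id)
open import Function.Bundles using (_⇔_; mk⇔; Equivalence)
open import Function.Construct.Composition using (_⇔-∘_)
open import Function.Construct.Symmetry using (⇔-sym)
open import Function.Definitions using (Injective)
open import Relation.Binary.Definitions using (tri<; tri≈; tri>)
open import Relation.Binary.PropositionalEquality
  using (_≡_; _≢_; refl; sym; trans; cong; cong₂; subst; subst₂; module ≡-Reasoning)
open import Relation.Nullary.Decidable
  using (Dec; yes; no; does; ¬?; _×-dec_; _⊎-dec_; _→-dec_; map′; dec-true; dec-false; from-yes)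
open import Relation.Nullary.Negation using (¬_; contradiction)
open import Relation.Unary using (Pred; Decidable)

private
  variable
    n k : ℕ

sum-mono-≤ : {f g : Fin n → ℕ} → (∀ i → f i ≤ g i) → sum f ≤ sum g
sum-mono-≤ {zero}  f≤g = z≤n
sum-mono-≤ {suc n} f≤g = +-mono-≤ (f≤g zero) (sum-mono-≤ (f≤g ∘ suc))

sum-const : ∀ n c → ∑[ i < n ] c ≡ n * c
sum-const zero    c = refl
sum-const (suc n) c = cong (c +_) (sum-const n c)

sum-*-sum : ∀ {m} (f : Fin m → ℕ) (g : Fin n → ℕ) → sum f * sum g ≡ ∑[ i < m ] ∑[ j < n ] (f i * g j)
sum-*-sum f g = trans (*-distribʳ-sum (sum g) f) (sum-cong-≗ (λ i → *-distribˡ-sum (f i) g))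

sum-pos : (f : Fin n → ℕ) → 0 < sum f → ∃ λ i → 0 < f i
sum-pos {suc n} f 0<Σ with f zero in f₀
... | suc _ = zero , subst (0 <_) (sym f₀) z<s
... | zero  with sum-pos (f ∘ suc) 0<Σ
...   | i , 0<fᵢ = suc i , 0<fᵢ

sum-zero : {f : Fin n → ℕ} → (∀ i → f i ≡ 0) → sum f ≡ 0
sum-zero {n} f≡0 = trans (sum-cong-≗ f≡0) (sum-replicate-zero n)

sum-≤1 : (f : Fin n → ℕ) → (∀ i → f i ≤ 1) → (∀ {i j} → 0 < f i → 0 < f j → i ≡ j) → sum f ≤ 1
sum-≤1 {zero}  f f≤1 unique = z≤n
sum-≤1 {suc n} f f≤1 unique with f zero in f₀
... | zero  = sum-≤1 (f ∘ suc) (f≤1 ∘ suc) (λ p q → suc-injective (unique p q))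
... | suc m = begin
  suc m + sum (f ∘ suc)  ≡⟨ cong (suc m +_) (sum-zero rest≡0) ⟩
  suc m + 0              ≡⟨ +-identityʳ (suc m) ⟩
  suc m                  ≡⟨ f₀ ⟨
  f zero                 ≤⟨ f≤1 zero ⟩
  1                      ∎
  where
  open ≤-Reasoning
  rest≡0 : ∀ i → f (suc i) ≡ 0
  rest≡0 i = n≤0⇒n≡0 (≮⇒≥ (0≢1+n ∘ unique (subst (0 <_) (sym f₀) z<s)))

+-≤1 : ∀ {a b} → a ≤ 1 → b ≤ 1 → (0 < a → 0 < b → ⊥) → a + b ≤ 1
+-≤1 {zero}  _ b≤1 _ = b≤1
+-≤1 {suc _} {zero}  a≤1 _ _ = subst (_≤ 1) (sym (+-identityʳ _)) a≤1
+-≤1 {suc _} {suc _} _ _ both = ⊥-elim (both z<s z<s)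

m≤n⇒2mn≤m²+n² : ∀ {m n} → m ≤ n → 2 * (m * n) ≤ m * m + n * n
m≤n⇒2mn≤m²+n² {m} m≤n with m≤n⇒∃[o]m+o≡n m≤n
... | d , refl = ≤-trans (m≤m+n _ (d * d)) (≤-reflexive (square-gap m d))
  where
  square-gap : ∀ m d → 2 * (m * (m + d)) + d * d ≡ m * m + (m + d) * (m + d)
  square-gap = solve-∀

2mn≤m²+n² : ∀ m n → 2 * (m * n) ≤ m * m + n * n
2mn≤m²+n² m n with ≤-total m n
... | inj₁ m≤n = m≤n⇒2mn≤m²+n² m≤n
... | inj₂ n≤m = subst₂ _≤_ (cong (2 *_) (*-comm n m)) (+-comm (n * n) (m * m)) (m≤n⇒2mn≤m²+n² n≤m)

sum²≤n*sum-of-squares : ∀ n (f : Fin n → ℕ) → sum f * sum f ≤ n * ∑[ i < n ] (f i * f i)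
sum²≤n*sum-of-squares n f = *-cancelˡ-≤ 2 (begin
  2 * (sum f * sum f)
    ≡⟨ cong (2 *_) (sum-*-sum f f) ⟩
  2 * ∑[ i < n ] ∑[ j < n ] (f i * f j)
    ≡⟨ *-distribˡ-sum 2 (λ i → ∑[ j < n ] (f i * f j)) ⟩
  ∑[ i < n ] (2 * ∑[ j < n ] (f i * f j))
    ≡⟨ sum-cong-≗ (λ i → *-distribˡ-sum 2 (λ j → f i * f j)) ⟩
  ∑[ i < n ] ∑[ j < n ] (2 * (f i * f j))
    ≤⟨ sum-mono-≤ (λ i → sum-mono-≤ (λ j → 2mn≤m²+n² (f i) (f j))) ⟩
  ∑[ i < n ] ∑[ j < n ] (f i * f i + f j * f j)
    ≡⟨ sum-cong-≗ (λ i → ∑-distrib-+ (λ _ → f i * f i) (λ j → f j * f j)) ⟩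
  ∑[ i < n ] (∑[ j < n ] (f i * f i) + Q)
    ≡⟨ ∑-distrib-+ (λ i → ∑[ j < n ] (f i * f i)) (λ _ → Q) ⟩
  ∑[ i < n ] ∑[ j < n ] (f i * f i) + ∑[ i < n ] Q
    ≡⟨ cong₂ _+_ (sum-cong-≗ (λ i → sum-const n (f i * f i))) (sum-const n Q) ⟩
  ∑[ i < n ] (n * (f i * f i)) + n * Q
    ≡⟨ cong (_+ n * Q) (*-distribˡ-sum n (λ i → f i * f i)) ⟨
  n * Q + n * Q
    ≡⟨ cong (n * Q +_) (+-identityʳ (n * Q)) ⟨
  2 * (n * Q) ∎)
  where
  open ≤-Reasoning
  Q = ∑[ i < n ] (f i * f i)

δ : Fin n → Fin n → ℕ
δ a b = if does (a ≟ b) then 1 else 0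

δ≤1 : (a b : Fin n) → δ a b ≤ 1
δ≤1 a b with a ≟ b
... | yes _ = s≤s z≤n
... | no  _ = z≤n

∑δ≡1 : (a : Fin n) → ∑[ b < n ] δ a b ≡ 1
∑δ≡1 {suc n} zero    = cong suc (sum-replicate-zero n)
∑δ≡1         (suc a) = ∑δ≡1 a

δ*δ-pos : {a b u v : Fin n} → 0 < δ a u * δ b v → a ≡ u × b ≡ v
δ*δ-pos {a = a} {b} {u} {v} pos with a ≟ u | b ≟ v
... | yes a≡u | yes b≡v = a≡u , b≡v
δ*δ-pos () | yes _ | no _
δ*δ-pos () | no _  | _

mantel-arithmetic : ∀ d n q → 2 * q ≤ d * n → d * d ≤ n * q → 2 * d ≤ n * n
mantel-arithmetic zero        n q _ _ = z≤n
mantel-arithmetic d@(suc _)   n q 2q≤dn d²≤nq = *-cancelʳ-≤ (2 * d) (n * n) d (begin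
  2 * d * d    ≡⟨ *-assoc 2 d d ⟩
  2 * (d * d)  ≤⟨ *-monoʳ-≤ 2 d²≤nq ⟩
  2 * (n * q)  ≡⟨ swap 2 n q ⟩
  n * (2 * q)  ≤⟨ *-monoʳ-≤ n 2q≤dn ⟩
  n * (d * n)  ≡⟨ rotate n d ⟩
  n * n * d    ∎)
  where
  open ≤-Reasoning
  swap : ∀ a b c → a * (b * c) ≡ b * (a * c)
  swap = solve-∀
  rotate : ∀ a b → a * (b * a) ≡ a * a * b
  rotate = solve-∀

module Mantel {n} (e : Fin n → Fin n → ℕ)
  (e-sym : ∀ u v → e u v ≡ e v u)
  (e≤1 : ∀ u v → e u v ≤ 1)
  (triangle-free : ∀ {x y z} → 0 < e x y → 0 < e y z → 0 < e x z → ⊥)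
  where

  degree : Fin n → ℕ
  degree u = ∑[ v < n ] e u v

  adjacent-degrees : ∀ {x y} → 0 < e x y → degree x + degree y ≤ n
  adjacent-degrees {x} {y} xy = begin
    degree x + degree y         ≡⟨ ∑-distrib-+ (e x) (e y) ⟨
    ∑[ w < n ] (e x w + e y w)  ≤⟨ sum-mono-≤ (λ w → +-≤1 (e≤1 x w) (e≤1 y w) (common-neighbour w)) ⟩
    ∑[ w < n ] 1                ≡⟨ sum-const n 1 ⟩
    n * 1                       ≡⟨ *-identityʳ n ⟩
    n                           ∎
    where
    open ≤-Reasoning
    common-neighbour : ∀ w → 0 < e x w → 0 < e y w → ⊥
    common-neighbour w xw yw = triangle-free xy yw xw

  weighted-adjacent-degrees : ∀ x y → e x y * (degree x + degree y) ≤ e x y * n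
  weighted-adjacent-degrees x y with e x y in exy
  ... | zero  = z≤n
  ... | suc m = *-monoʳ-≤ (suc m) (adjacent-degrees (subst (0 <_) (sym exy) z<s))

  Q : ℕ
  Q = ∑[ x < n ] (degree x * degree x)

  ∑∑-weighted-degree : ∑[ x < n ] ∑[ y < n ] (e x y * degree x) ≡ Q
  ∑∑-weighted-degree = sum-cong-≗ (λ x → sym (*-distribʳ-sum (degree x) (e x)))

  ∑∑-adjacent-degrees : ∑[ x < n ] ∑[ y < n ] (e x y * (degree x + degree y)) ≡ 2 * Q
  ∑∑-adjacent-degrees = begin
    ∑[ x < n ] ∑[ y < n ] (e x y * (degree x + degree y))
      ≡⟨ sum-cong-≗ (λ x → sum-cong-≗ (λ y → *-distribˡ-+ (e x y) (degree x) (degree y))) ⟩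
    ∑[ x < n ] ∑[ y < n ] (e x y * degree x + e x y * degree y)
      ≡⟨ sum-cong-≗ (λ x → ∑-distrib-+ (λ y → e x y * degree x) (λ y → e x y * degree y)) ⟩
    ∑[ x < n ] (∑[ y < n ] (e x y * degree x) + ∑[ y < n ] (e x y * degree y))
      ≡⟨ ∑-distrib-+ (λ x → ∑[ y < n ] (e x y * degree x)) (λ x → ∑[ y < n ] (e x y * degree y)) ⟩
    ∑[ x < n ] ∑[ y < n ] (e x y * degree x) + ∑[ x < n ] ∑[ y < n ] (e x y * degree y)
      ≡⟨ cong₂ _+_ ∑∑-weighted-degree (∑-comm (λ x y → e x y * degree y)) ⟩
    Q + ∑[ y < n ] ∑[ x < n ] (e x y * degree y)
      ≡⟨ cong (Q +_) (trans (sum-cong-≗ (λ y → sum-cong-≗ (λ x → cong (_* degree y) (e-sym x y))))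
                            ∑∑-weighted-degree) ⟩
    Q + Q
      ≡⟨ cong (Q +_) (+-identityʳ Q) ⟨
    2 * Q ∎
    where open ≡-Reasoning

  -- Summing degree x + degree y over the edges counts ∑ d², so 2 ∑ d² ≤ n ∑ d; together with
  -- (∑ d)² ≤ n ∑ d² this bounds 2 ∑ d = 4 · #edges by n².
  mantel : 2 * ∑[ u < n ] degree u ≤ n * n
  mantel = mantel-arithmetic (sum degree) n Q 2Q≤Dn (sum²≤n*sum-of-squares n degree)
    where
    open ≤-Reasoning
    2Q≤Dn : 2 * Q ≤ sum degree * n
    2Q≤Dn = begin
      2 * Q                                                  ≡⟨ ∑∑-adjacent-degrees ⟨
      ∑[ x < n ] ∑[ y < n ] (e x y * (degree x + degree y))
        ≤⟨ sum-mono-≤ (λ x → sum-mono-≤ (weighted-adjacent-degrees x)) ⟩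
      ∑[ x < n ] ∑[ y < n ] (e x y * n)                      ≡⟨ sum-cong-≗ (λ x → *-distribʳ-sum n (e x)) ⟨
      ∑[ x < n ] (degree x * n)                              ≡⟨ *-distribʳ-sum n degree ⟨
      sum degree * n                                         ∎

module EdgeList {n k} (src tgt : Fin k → Fin n) where

  Arc : Fin k → Fin n → Fin n → Set
  Arc i u v = src i ≡ u × tgt i ≡ v

  Joins : Fin k → Fin n → Fin n → Set
  Joins i u v = Arc i u v ⊎ Arc i v u

  multiplicity : Fin k → Fin n → Fin n → ℕ
  multiplicity i u v = δ (src i) u * δ (tgt i) v + δ (src i) v * δ (tgt i) u

  multiplicity-pos : ∀ {i u v} → 0 < multiplicity i u v → Joins i u v
  multiplicity-pos {i} {u} {v} pos with δ (src i) u * δ (tgt i) v in arc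
  ... | suc _ = inj₁ (δ*δ-pos {a = src i} {tgt i} {u} {v} (subst (0 <_) (sym arc) z<s))
  ... | zero  = inj₂ (δ*δ-pos {a = src i} {tgt i} {v} {u} pos)

  multiplicity≤1 : ∀ {i} → src i ≢ tgt i → ∀ u v → multiplicity i u v ≤ 1
  multiplicity≤1 {i} src≢tgt u v = +-≤1 (δ*δ≤1 u v) (δ*δ≤1 v u) both
    where
    δ*δ≤1 : ∀ u v → δ (src i) u * δ (tgt i) v ≤ 1
    δ*δ≤1 u v = *-mono-≤ (δ≤1 (src i) u) (δ≤1 (tgt i) v)
    both : 0 < δ (src i) u * δ (tgt i) v → 0 < δ (src i) v * δ (tgt i) u → ⊥
    both p q = src≢tgt (trans (proj₁ (δ*δ-pos {a = src i} {tgt i} {u} {v} p))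
                              (sym (proj₂ (δ*δ-pos {a = src i} {tgt i} {v} {u} q))))

  ∑∑-multiplicity : ∀ i → ∑[ u < n ] ∑[ v < n ] multiplicity i u v ≡ 2
  ∑∑-multiplicity i = begin
    ∑[ u < n ] ∑[ v < n ] (δ a u * δ b v + δ a v * δ b u)
      ≡⟨ sum-cong-≗ (λ u → ∑-distrib-+ (λ v → δ a u * δ b v) (λ v → δ a v * δ b u)) ⟩
    ∑[ u < n ] (∑[ v < n ] (δ a u * δ b v) + ∑[ v < n ] (δ a v * δ b u))
      ≡⟨ ∑-distrib-+ (λ u → ∑[ v < n ] (δ a u * δ b v)) (λ u → ∑[ v < n ] (δ a v * δ b u)) ⟩
    ∑[ u < n ] ∑[ v < n ] (δ a u * δ b v) + ∑[ u < n ] ∑[ v < n ] (δ a v * δ b u)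
      ≡⟨ cong₂ _+_ ∑∑δ*δ≡1 (trans (∑-comm (λ u v → δ a v * δ b u)) ∑∑δ*δ≡1) ⟩
    2 ∎
    where
    open ≡-Reasoning
    a = src i
    b = tgt i
    ∑∑δ*δ≡1 : ∑[ u < n ] ∑[ v < n ] (δ a u * δ b v) ≡ 1
    ∑∑δ*δ≡1 = trans (sym (sum-*-sum (δ a) (δ b))) (cong₂ _*_ (∑δ≡1 a) (∑δ≡1 b))

  adjacency : Fin n → Fin n → ℕ
  adjacency u v = ∑[ i < k ] multiplicity i u v

  adjacency-pos : ∀ {u v} → 0 < adjacency u v → ∃ λ i → Joins i u v
  adjacency-pos pos with sum-pos _ pos
  ... | i , 0<mᵢ = i , multiplicity-pos 0<mᵢ

  adjacency-sym : ∀ u v → adjacency u v ≡ adjacency v u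
  adjacency-sym u v = sum-cong-≗ (λ i → +-comm (δ (src i) u * δ (tgt i) v) _)

  ∑∑-adjacency : ∑[ u < n ] ∑[ v < n ] adjacency u v ≡ k * 2
  ∑∑-adjacency = begin
    ∑[ u < n ] ∑[ v < n ] ∑[ i < k ] multiplicity i u v
      ≡⟨ sum-cong-≗ (λ u → ∑-comm (λ v i → multiplicity i u v)) ⟩
    ∑[ u < n ] ∑[ i < k ] ∑[ v < n ] multiplicity i u v
      ≡⟨ ∑-comm (λ u i → ∑[ v < n ] multiplicity i u v) ⟩
    ∑[ i < k ] ∑[ u < n ] ∑[ v < n ] multiplicity i u v
      ≡⟨ sum-cong-≗ ∑∑-multiplicity ⟩
    ∑[ i < k ] 2
      ≡⟨ sum-const k 2 ⟩
    k * 2 ∎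
    where open ≡-Reasoning

  module _ (Joins-unique : ∀ {i j u v} → Joins i u v → Joins j u v → i ≡ j)
           (triangle-free : ∀ {i j m x y z} → Joins i x y → Joins j y z → Joins m x z → ⊥)
    where

    src≢tgt : ∀ i → src i ≢ tgt i
    src≢tgt i s≡t = triangle-free loop loop loop
      where
      loop : Joins i (src i) (src i)
      loop = inj₁ (refl , sym s≡t)

    adjacency≤1 : ∀ u v → adjacency u v ≤ 1
    adjacency≤1 u v = sum-≤1 _ (λ i → multiplicity≤1 (src≢tgt i) u v)
                               (λ p q → Joins-unique (multiplicity-pos p) (multiplicity-pos q))

    adjacency-triangle-free : ∀ {x y z} → 0 < adjacency x y → 0 < adjacency y z → 0 < adjacency x z → ⊥
    adjacency-triangle-free xy yz xz =
      triangle-free (proj₂ (adjacency-pos xy)) (proj₂ (adjacency-pos yz)) (proj₂ (adjacency-pos xz))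

    mantel : k * 4 ≤ n * n
    mantel = subst (_≤ n * n) 2*[k*2]≡k*4 (subst (λ d → 2 * d ≤ n * n) ∑∑-adjacency
      (Mantel.mantel adjacency adjacency-sym adjacency≤1 adjacency-triangle-free))
      where
      2*[k*2]≡k*4 : 2 * (k * 2) ≡ k * 4
      2*[k*2]≡k*4 = trans (*-comm 2 (k * 2)) (*-assoc k 2 2)

dec-true⁻¹ : ∀ {p} {P : Set p} (P? : Dec P) → does P? ≡ true → P
dec-true⁻¹ (yes p) _ = p

does≡⇒⇔ : ∀ {p} {P : Set p} (P? : Dec P) {b} → does P? ≡ b → P ⇔ b ≡ true
does≡⇒⇔ P? refl = mk⇔ (dec-true P?) (dec-true⁻¹ P?)

related⇒≢ : {R : BRel n} → IsPartialOrder R → ∀ {a b} → R a b ≡ true → a ≢ b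
related⇒≢ (irrefl , _) Rab refl = not-¬ Rab (irrefl _)

asymmetric : {R : BRel n} → IsPartialOrder R → ∀ {a b} → R a b ≡ true → R b a ≡ true → ⊥
asymmetric (irrefl , trans′) Rab Rba = not-¬ (trans′ _ _ _ Rab Rba) (irrefl _)

total-flip : {R : BRel n} → IsTotalOrder R → ∀ {a b} → a ≢ b → R a b ≡ false → R b a ≡ true
total-flip (_ , connex) {a} {b} a≢b Rab with connex a b a≢b
... | inj₁ Rab≡true = ⊥-elim (not-¬ Rab≡true Rab)
... | inj₂ Rba      = Rba

⊆⇔compatible : {A B : BRel n} → IsTotalOrder B → A ⊆ᴿ B ⇔ Compatible B A
⊆⇔compatible {A = A} {B} (B-po , connex) = mk⇔ (λ A⊆B → B , B-po , (λ _ _ → id) , A⊆B) compatible⇒⊆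
  where
  compatible⇒⊆ : Compatible B A → A ⊆ᴿ B
  compatible⇒⊆ (T , T-po , B⊆T , A⊆T) x y Axy with connex x y (related⇒≢ T-po (A⊆T x y Axy))
  ... | inj₁ Bxy = Bxy
  ... | inj₂ Byx = ⊥-elim (asymmetric T-po (A⊆T x y Axy) (B⊆T y x Byx))

_⇒ᴿ?_ : (A B : BRel n) → ∀ x y → Dec (A x y ≡ true → B x y ≡ true)
(A ⇒ᴿ? B) x y = (A x y ≟ᵇ true) →-dec (B x y ≟ᵇ true)

_⊆ᴿ?_ : (A B : BRel n) → Dec (A ⊆ᴿ B)
A ⊆ᴿ? B = all? λ x → all? λ y → (A ⇒ᴿ? B) x y

⊈⇒∃ : {A B : BRel n} → ¬ (A ⊆ᴿ B) → ∃₂ λ x y → A x y ≡ true × B x y ≡ false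
⊈⇒∃ {n} {A} {B} A⊈B with ¬∀⟶∃¬ n _ (λ x → all? ((A ⇒ᴿ? B) x)) A⊈B
... | x , ¬all with ¬∀⟶∃¬ n _ ((A ⇒ᴿ? B) x) ¬all
...   | y , ¬contained with A x y in Axy | B x y in Bxy
...     | true  | false = x , y , Axy , Bxy
...     | true  | true  = ⊥-elim (¬contained (λ _ → refl))
...     | false | _     = ⊥-elim (¬contained (λ ()))

isPartialOrder? : (R : BRel n) → Dec (IsPartialOrder R)
isPartialOrder? R =
  (all? λ a → R a a ≟ᵇ false) ×-dec
  (all? λ a → all? λ b → all? λ c → (R a b ≟ᵇ true) →-dec ((R b c ≟ᵇ true) →-dec (R a c ≟ᵇ true)))

isTotalOrder? : (R : BRel n) → Dec (IsTotalOrder R)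
isTotalOrder? R =
  isPartialOrder? R ×-dec (all? λ a → all? λ b → ¬? (a ≟ b) →-dec ((R a b ≟ᵇ true) ⊎-dec (R b a ≟ᵇ true)))

∀-Bool? : ∀ {p} {P : Bool → Set p} → (∀ b → Dec (P b)) → Dec (∀ b → P b)
∀-Bool? P? = map′ (λ (t , f) → λ { true → t ; false → f }) (λ h → h true , h false) (P? true ×-dec P? false)

module _ {S : TotalOrderSet n k} where

  shattered⇒cut : Shattered S → ∀ {p} {P : Pred (Fin k) p} → Decidable P →
                  ∃ λ A → IsPartialOrder A × (∀ i → A ⊆ᴿ elem S i ⇔ P i)
  shattered⇒cut shattered P? with shattered (does ∘ P?)
  ... | A , A-po , compatible⇔ = A , A-po , λ i →
    ⇔-sym (does≡⇒⇔ (P? i) refl) ⇔-∘ (compatible⇔ i ⇔-∘ ⊆⇔compatible (total S i))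

  cut⇒shattered : (∀ X → ∃ λ A → IsPartialOrder A × (∀ i → A ⊆ᴿ elem S i ⇔ X i ≡ true)) → Shattered S
  cut⇒shattered cut X with cut X
  ... | A , A-po , ⊆⇔ = A , A-po , λ i → ⊆⇔ i ⇔-∘ ⇔-sym (⊆⇔compatible (total S i))

record Flips (S : TotalOrderSet n k) (i : Fin k) (x y : Fin n) : Set where
  field
    reversed : elem S i x y ≡ false
    kept     : ∀ j → j ≢ i → elem S j x y ≡ true

module _ {S : TotalOrderSet n k} where
  open Flips

  shattered⇒flips : Shattered S → ∀ i → ∃₂ λ x y → x ≢ y × Flips S i x y
  shattered⇒flips shattered i with shattered⇒cut {S = S} shattered (λ j → ¬? (j ≟ i))
  ... | A , A-po , A⊆⇔ with ⊈⇒∃ (λ A⊆Bᵢ → Equivalence.to (A⊆⇔ i) A⊆Bᵢ refl)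
  ...   | x , y , Axy , Bᵢxy = x , y , related⇒≢ A-po Axy ,
          record { reversed = Bᵢxy ; kept = λ j j≢i → Equivalence.from (A⊆⇔ j) j≢i x y Axy }

  private
    order : ∀ t → IsPartialOrder (elem S t)
    order t = proj₁ (total S t)

  flips-unique : ∀ {i j x y} → Flips S i x y → Flips S j x y → i ≡ j
  flips-unique {i} {j} fᵢ fⱼ with i ≟ j
  ... | yes i≡j = i≡j
  ... | no  i≢j = ⊥-elim (not-¬ (kept fᵢ j (i≢j ∘ sym)) (reversed fⱼ))

  flips-opposite : ∀ {i j t x y} → Flips S i x y → Flips S j y x → t ≢ i → t ≢ j → ⊥
  flips-opposite {t = t} fᵢ fⱼ t≢i t≢j = asymmetric (order t) (kept fᵢ t t≢i) (kept fⱼ t t≢j)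

  flips-transitive : ∀ {i j m p q r} → Flips S i p q → Flips S j q r → Flips S m p r → m ≢ i → m ≢ j → ⊥
  flips-transitive {m = m} fᵢ fⱼ fₘ m≢i m≢j =
    not-¬ (proj₂ (order m) _ _ _ (kept fᵢ m m≢i) (kept fⱼ m m≢j)) (reversed fₘ)

  flips-cyclic : ∀ {i j m t p q r} → Flips S i p q → Flips S j q r → Flips S m r p →
                 t ≢ i → t ≢ j → t ≢ m → ⊥
  flips-cyclic {t = t} fᵢ fⱼ fₘ t≢i t≢j t≢m =
    asymmetric (order t) (proj₂ (order t) _ _ _ (kept fᵢ t t≢i) (kept fⱼ t t≢j)) (kept fₘ t t≢m)

∃-∉ : (xs : List (Fin k)) → length xs < k → ∃ (_∉ xs)
∃-∉ {k} xs |xs|<k = ¬∀⟶∃¬ k _ (λ t → any? (t ≟_) xs) all∈⇒⊥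
  where
  all∈⇒⊥ : ¬ (∀ t → t ∈ xs)
  all∈⇒⊥ all∈ = <⇒≱ |xs|<k (injective⇒≤ position-injective)
    where
    position-injective : Injective _≡_ _≡_ (λ t → index (all∈ t))
    position-injective {t} {t′} same-position =
      trans (lookup-index (all∈ t)) (trans (cong (lookup xs) same-position) (sym (lookup-index (all∈ t′))))

module FlipGraph (S : TotalOrderSet n k) (shattered : Shattered S) (4≤k : 4 ≤ k) where

  flip-pair : ∀ i → ∃₂ λ x y → x ≢ y × Flips S i x y
  flip-pair = shattered⇒flips {S = S} shattered

  src tgt : Fin k → Fin n
  src i = proj₁ (flip-pair i)
  tgt i = proj₁ (proj₂ (flip-pair i))

  open EdgeList src tgt using (Arc; Joins; mantel)

  arc-≢ : ∀ {i u v} → Arc i u v → u ≢ v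
  arc-≢ {i} (refl , refl) = proj₁ (proj₂ (proj₂ (flip-pair i)))

  arc-flips : ∀ {i u v} → Arc i u v → Flips S i u v
  arc-flips {i} (refl , refl) = proj₂ (proj₂ (proj₂ (flip-pair i)))

  fresh : (i j m : Fin k) → ∃ λ t → t ≢ i × t ≢ j × t ≢ m
  fresh i j m with ∃-∉ (i ∷ j ∷ m ∷ []) 4≤k
  ... | t , t∉ = t , t∉ ∘ here , t∉ ∘ there ∘ here , t∉ ∘ there ∘ there ∘ here

  no-opposite-arcs : ∀ {i j u v} → Arc i u v → Arc j v u → ⊥
  no-opposite-arcs {i} {j} aᵢ aⱼ with fresh i j j
  ... | t , t≢i , t≢j , _ = flips-opposite (arc-flips aᵢ) (arc-flips aⱼ) t≢i t≢j

  no-transitive-triangle : ∀ {i j m p q r} → Arc i p q → Arc j q r → Arc m p r → ⊥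
  no-transitive-triangle {i} {j} {m} aᵢ aⱼ aₘ with m ≟ i | m ≟ j
  ... | yes refl | _        = arc-≢ aⱼ (trans (sym (proj₂ aᵢ)) (proj₂ aₘ))
  ... | no _     | yes refl = arc-≢ aᵢ (trans (sym (proj₁ aₘ)) (proj₁ aⱼ))
  ... | no m≢i   | no m≢j   = flips-transitive (arc-flips aᵢ) (arc-flips aⱼ) (arc-flips aₘ) m≢i m≢j

  -- The only step needing a fourth order: the three rotations of [3] flip a cyclic triangle.
  no-cyclic-triangle : ∀ {i j m p q r} → Arc i p q → Arc j q r → Arc m r p → ⊥
  no-cyclic-triangle {i} {j} {m} aᵢ aⱼ aₘ with fresh i j m
  ... | t , t≢i , t≢j , t≢m = flips-cyclic (arc-flips aᵢ) (arc-flips aⱼ) (arc-flips aₘ) t≢i t≢j t≢m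

  Joins-unique : ∀ {i j u v} → Joins i u v → Joins j u v → i ≡ j
  Joins-unique (inj₁ aᵢ) (inj₁ aⱼ) = flips-unique (arc-flips aᵢ) (arc-flips aⱼ)
  Joins-unique (inj₂ aᵢ) (inj₂ aⱼ) = flips-unique (arc-flips aᵢ) (arc-flips aⱼ)
  Joins-unique (inj₁ aᵢ) (inj₂ aⱼ) = ⊥-elim (no-opposite-arcs aᵢ aⱼ)
  Joins-unique (inj₂ aᵢ) (inj₁ aⱼ) = ⊥-elim (no-opposite-arcs aᵢ aⱼ)

  triangle-free : ∀ {i j m x y z} → Joins i x y → Joins j y z → Joins m x z → ⊥
  triangle-free (inj₁ a) (inj₁ b) (inj₁ c) = no-transitive-triangle a b c
  triangle-free (inj₁ a) (inj₁ b) (inj₂ c) = no-cyclic-triangle a b c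
  triangle-free (inj₁ a) (inj₂ b) (inj₁ c) = no-transitive-triangle c b a
  triangle-free (inj₁ a) (inj₂ b) (inj₂ c) = no-transitive-triangle c a b
  triangle-free (inj₂ a) (inj₁ b) (inj₁ c) = no-transitive-triangle a c b
  triangle-free (inj₂ a) (inj₁ b) (inj₂ c) = no-transitive-triangle b c a
  triangle-free (inj₂ a) (inj₂ b) (inj₁ c) = no-cyclic-triangle c b a
  triangle-free (inj₂ a) (inj₂ b) (inj₂ c) = no-transitive-triangle b a c

  k*4≤n*n : k * 4 ≤ n * n
  k*4≤n*n = mantel Joins-unique triangle-free

Fin2-≢-pairs : {x y u v : Fin 2} → x ≢ y → u ≢ v → (u ≡ x × v ≡ y) ⊎ (u ≡ y × v ≡ x)
Fin2-≢-pairs {0F} {0F} x≢y _   = contradiction refl x≢y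
Fin2-≢-pairs {1F} {1F} x≢y _   = contradiction refl x≢y
Fin2-≢-pairs {u = 0F} {0F} _ u≢v = contradiction refl u≢v
Fin2-≢-pairs {u = 1F} {1F} _ u≢v = contradiction refl u≢v
Fin2-≢-pairs {0F} {1F} {0F} {1F} _ _ = inj₁ (refl , refl)
Fin2-≢-pairs {0F} {1F} {1F} {0F} _ _ = inj₂ (refl , refl)
Fin2-≢-pairs {1F} {0F} {0F} {1F} _ _ = inj₂ (refl , refl)
Fin2-≢-pairs {1F} {0F} {1F} {0F} _ _ = inj₁ (refl , refl)

Fin2-total-orders-agree : {B B′ : BRel 2} → IsTotalOrder B → IsTotalOrder B′ → ∀ {x y} → x ≢ y →
                          B x y ≡ false → B′ x y ≡ false → ∀ u v → B u v ≡ B′ u v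
Fin2-total-orders-agree B-total B′-total x≢y Bxy B′xy u v with u ≟ v
... | yes refl = trans (proj₁ (proj₁ B-total) u) (sym (proj₁ (proj₁ B′-total) u))
... | no u≢v with Fin2-≢-pairs x≢y u≢v
...   | inj₁ (refl , refl) = trans Bxy (sym B′xy)
...   | inj₂ (refl , refl) = trans (total-flip B-total x≢y Bxy) (sym (total-flip B′-total x≢y B′xy))

module _ {S : TotalOrderSet n k} (shattered : Shattered S) where

  incompatible-with-all : ∃ λ A → IsPartialOrder A × (∀ i → ¬ (A ⊆ᴿ elem S i))
  incompatible-with-all with shattered⇒cut {S = S} shattered {P = λ _ → ⊥} (λ _ → no id)
  ... | A , A-po , A⊆⇔ = A , A-po , Equivalence.to ∘ A⊆⇔

Fin1-unshatterable : (S : TotalOrderSet 1 (suc k)) → ¬ Shattered S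
Fin1-unshatterable S shattered with incompatible-with-all {S = S} shattered
... | A , A-po , A⊈ = A⊈ 0F λ { 0F 0F A00 → ⊥-elim (related⇒≢ A-po A00 refl) }

Fin2-unshatterable : (S : TotalOrderSet 2 (2 + k)) → ¬ Shattered S
Fin2-unshatterable S shattered with incompatible-with-all {S = S} shattered
... | A , A-po , A⊈ with ⊈⇒∃ (A⊈ 0F) | ⊈⇒∃ (A⊈ 1F)
...   | x , y , Axy , B₀xy | x′ , y′ , Ax′y′ , B₁x′y′
      with Fin2-≢-pairs (related⇒≢ A-po Axy) (related⇒≢ A-po Ax′y′)
...     | inj₁ (refl , refl) = 0≢1+n (distinct S 0F 1F
            (Fin2-total-orders-agree (total S 0F) (total S 1F) (related⇒≢ A-po Axy) B₀xy B₁x′y′))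
...     | inj₂ (refl , refl) = asymmetric A-po Axy Ax′y′

n*n/4≤vcValue : ∀ n → (n * n) / 4 ≤ vcValue n
n*n/4≤vcValue 0 = z≤n
n*n/4≤vcValue 1 = z≤n
n*n/4≤vcValue 2 = ≤-refl
n*n/4≤vcValue 3 = s≤s (s≤s z≤n)
n*n/4≤vcValue (suc (suc (suc (suc _)))) = ≤-refl

3≤vcValue : ∀ n → 3 ≤ vcValue (3 + n)
3≤vcValue zero    = ≤-refl
3≤vcValue (suc n) = ≤-trans (s≤s (s≤s (s≤s z≤n))) (/-monoˡ-≤ 4 (*-mono-≤ 4≤m 4≤m))
  where
  4≤m : 4 ≤ 4 + n
  4≤m = m≤m+n 4 n

small-upper-bound : ∀ n k → 1 ≤ n → k ≤ 3 → (S : TotalOrderSet n k) → Shattered S → k ≤ vcValue n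
small-upper-bound 1                   0             _ _   _ _ = z≤n
small-upper-bound 1                   (suc _)       _ _   S sh = ⊥-elim (Fin1-unshatterable S sh)
small-upper-bound 2                   0             _ _   _ _ = z≤n
small-upper-bound 2                   1             _ _   _ _ = s≤s z≤n
small-upper-bound 2                   (suc (suc _)) _ _   S sh = ⊥-elim (Fin2-unshatterable S sh)
small-upper-bound (suc (suc (suc n))) _             _ k≤3 _ _ = ≤-trans k≤3 (3≤vcValue n)

upper-bound : 1 ≤ n → (S : TotalOrderSet n k) → Shattered S → k ≤ vcValue n
upper-bound {n} {k} 1≤n S shattered with 4 ≤ℕ? k
... | no  k≱4 = small-upper-bound n k 1≤n (≤-pred (≰⇒> k≱4)) S shattered
... | yes 4≤k = begin
  k              ≡⟨ m*n/n≡m k 4 ⟨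
  k * 4 / 4      ≤⟨ /-monoˡ-≤ 4 (FlipGraph.k*4≤n*n S shattered 4≤k) ⟩
  (n * n) / 4    ≤⟨ n*n/4≤vcValue n ⟩
  vcValue n      ∎
  where open ≤-Reasoning

rankOrder : (Fin n → ℕ) → BRel n
rankOrder f a b = does (f a <ℕ? f b)

rankOrder-< : (f : Fin n → ℕ) → ∀ {a b} → f a < f b → rankOrder f a b ≡ true
rankOrder-< f {a} {b} = dec-true (f a <ℕ? f b)

rankOrder-> : (f : Fin n → ℕ) → ∀ {a b} → f b < f a → rankOrder f a b ≡ false
rankOrder-> f {a} {b} fb<fa = dec-false (f a <ℕ? f b) (<-asym fb<fa)

rankOrder-isTotalOrder : {f : Fin n → ℕ} → Injective _≡_ _≡_ f → IsTotalOrder (rankOrder f)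
rankOrder-isTotalOrder {f = f} f-injective = (irreflexive , transitive) , connex
  where
  irreflexive : ∀ a → rankOrder f a a ≡ false
  irreflexive a = dec-false (f a <ℕ? f a) (n≮n (f a))
  transitive : ∀ a b c → rankOrder f a b ≡ true → rankOrder f b c ≡ true → rankOrder f a c ≡ true
  transitive a b c ab bc =
    rankOrder-< f (<-trans (dec-true⁻¹ (f a <ℕ? f b) ab) (dec-true⁻¹ (f b <ℕ? f c) bc))
  connex : ∀ a b → a ≢ b → rankOrder f a b ≡ true ⊎ rankOrder f b a ≡ true
  connex a b a≢b with <-cmp (f a) (f b)
  ... | tri< fa<fb _ _ = inj₁ (rankOrder-< f fa<fb)
  ... | tri≈ _ fa≡fb _ = contradiction (f-injective fa≡fb) a≢b
  ... | tri> _ _ fb<fa = inj₂ (rankOrder-< f fb<fa)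

module Bipartite (p q : ℕ) where

  -- The four blocks of B_LR; within a block, `combine` orders vertices as in Fin (p + q).
  level : Fin p → Fin q → Fin p ⊎ Fin q → Fin 4
  level L R (inj₁ l) = if does (l ≟ L) then 2F else 0F
  level L R (inj₂ h) = if does (h ≟ R) then 1F else 3F

  level-R<L : ∀ L R → level L R (inj₂ R) Fin.< level L R (inj₁ L)
  level-R<L L R rewrite dec-true (L ≟ L) refl | dec-true (R ≟ R) refl = s≤s (s≤s z≤n)

  level-low<high : ∀ {L R l h} → ¬ (l ≡ L × h ≡ R) → level L R (inj₁ l) Fin.< level L R (inj₂ h)
  level-low<high {L} {R} {l} {h} ≢LR with l ≟ L | h ≟ R
  ... | no  _   | no  _   = z<s
  ... | no  _   | yes _   = z<s
  ... | yes _   | no  _   = s≤s (s≤s (s≤s z≤n))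
  ... | yes l≡L | yes h≡R = contradiction (l≡L , h≡R) ≢LR

  rank : Fin p → Fin q → Fin (p + q) → ℕ
  rank L R v = toℕ (combine (level L R (splitAt p v)) v)

  flipOrder : Fin p → Fin q → BRel (p + q)
  flipOrder L R = rankOrder (rank L R)

  flipOrder-isTotalOrder : ∀ L R → IsTotalOrder (flipOrder L R)
  flipOrder-isTotalOrder L R = rankOrder-isTotalOrder λ {u} {w} same-rank →
    combine-injectiveʳ (level L R (splitAt p u)) u (level L R (splitAt p w)) w (toℕ-injective same-rank)

  flipOrder-reverses : ∀ L R → flipOrder L R (L ↑ˡ q) (p ↑ʳ R) ≡ false
  flipOrder-reverses L R = rankOrder-> (rank L R) (combine-monoˡ-< _ _ R<L)
    where
    R<L : level L R (splitAt p (p ↑ʳ R)) Fin.< level L R (splitAt p (L ↑ˡ q))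
    R<L rewrite splitAt-↑ˡ p L q | splitAt-↑ʳ p q R = level-R<L L R

  flipOrder-ascends : ∀ {L R} u w → level L R (splitAt p u) Fin.< level L R (splitAt p w) →
                      flipOrder L R u w ≡ true
  flipOrder-ascends {L} {R} u w lower = rankOrder-< (rank L R) (combine-monoˡ-< u w lower)

  flipOrder-keeps : ∀ {L R} l h → ¬ (l ≡ L × h ≡ R) → flipOrder L R (l ↑ˡ q) (p ↑ʳ h) ≡ true
  flipOrder-keeps {L} {R} l h ≢LR = flipOrder-ascends _ _ low<high
    where
    low<high : level L R (splitAt p (l ↑ˡ q)) Fin.< level L R (splitAt p (p ↑ʳ h))
    low<high rewrite splitAt-↑ˡ p l q | splitAt-↑ʳ p q h = level-low<high ≢LR

  crossing⊎ : (Fin p → Fin q → Bool) → Fin p ⊎ Fin q → Fin p ⊎ Fin q → Bool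
  crossing⊎ Z (inj₁ l) (inj₂ h) = not (Z l h)
  crossing⊎ Z _        _        = false

  crossing : (Fin p → Fin q → Bool) → BRel (p + q)
  crossing Z u w = crossing⊎ Z (splitAt p u) (splitAt p w)

  crossing-isPartialOrder : ∀ Z → IsPartialOrder (crossing Z)
  crossing-isPartialOrder Z =
    (λ u → irreflexive (splitAt p u)) , (λ u v w → transitive (splitAt p u) (splitAt p v) (splitAt p w))
    where
    irreflexive : ∀ s → crossing⊎ Z s s ≡ false
    irreflexive (inj₁ _) = refl
    irreflexive (inj₂ _) = refl
    transitive : ∀ s t r → crossing⊎ Z s t ≡ true → crossing⊎ Z t r ≡ true → crossing⊎ Z s r ≡ true
    transitive (inj₁ _) (inj₁ _) _        ()
    transitive (inj₁ _) (inj₂ _) (inj₁ _) _ ()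
    transitive (inj₁ _) (inj₂ _) (inj₂ _) _ ()
    transitive (inj₂ _) _        _        ()

  crossing⊆flipOrder⇔ : ∀ Z L R → crossing Z ⊆ᴿ flipOrder L R ⇔ Z L R ≡ true
  crossing⊆flipOrder⇔ Z L R = mk⇔ ⊆⇒selected selected⇒⊆
    where
    ⊆⇒selected : crossing Z ⊆ᴿ flipOrder L R → Z L R ≡ true
    ⊆⇒selected ⊆ with Z L R in ZLR
    ... | true  = refl
    ... | false = ⊥-elim (not-¬ (⊆ _ _ crossing-LR) (flipOrder-reverses L R))
      where
      crossing-LR : crossing Z (L ↑ˡ q) (p ↑ʳ R) ≡ true
      crossing-LR rewrite splitAt-↑ˡ p L q | splitAt-↑ʳ p q R | ZLR = refl
    selected⇒⊆ : Z L R ≡ true → crossing Z ⊆ᴿ flipOrder L R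
    selected⇒⊆ ZLR u w = flipOrder-ascends u w ∘ ascending (splitAt p u) (splitAt p w)
      where
      ascending : ∀ s t → crossing⊎ Z s t ≡ true → level L R s Fin.< level L R t
      ascending (inj₁ l) (inj₂ h) ¬Zlh = level-low<high {L} {R} {l} {h}
        λ { (refl , refl) → not-¬ ZLR (not-injective {y = false} ¬Zlh) }
      ascending (inj₁ _) (inj₁ _) ()
      ascending (inj₂ _) _        ()

  flipOrder-injective : ∀ {L R L′ R′} → (∀ a b → flipOrder L R a b ≡ flipOrder L′ R′ a b) →
                        (L , R) ≡ (L′ , R′)
  flipOrder-injective {L} {R} {L′} {R′} same with L ≟ L′ | R ≟ R′
  ... | yes refl | yes refl = refl
  ... | no L≢L′  | _        = ⊥-elim (not-¬ (trans (same _ _) (flipOrder-keeps L R (L≢L′ ∘ proj₁)))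
                                            (flipOrder-reverses L R))
  ... | _        | no R≢R′  = ⊥-elim (not-¬ (trans (same _ _) (flipOrder-keeps L R (R≢R′ ∘ proj₂)))
                                            (flipOrder-reverses L R))

  pair : Fin (p * q) → Fin p × Fin q
  pair = remQuot {p} q

  combine-pair : ∀ i → uncurry combine (pair i) ≡ i
  combine-pair = combine-remQuot {p} q

  flipOrders : TotalOrderSet (p + q) (p * q)
  flipOrders = record
    { elem     = uncurry flipOrder ∘ pair
    ; total    = uncurry flipOrder-isTotalOrder ∘ pair
    ; distinct = λ i j same → trans (sym (combine-pair i))
                   (trans (cong (uncurry combine) (flipOrder-injective same)) (combine-pair j))
    }

  flipOrders-shattered : Shattered flipOrders
  flipOrders-shattered = cut⇒shattered {S = flipOrders} λ X →
    let Z = λ l h → X (combine l h) in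
    crossing Z , crossing-isPartialOrder Z , λ i →
      subst (λ j → crossing Z ⊆ᴿ elem flipOrders i ⇔ X j ≡ true) (combine-pair i)
            (uncurry (crossing⊆flipOrder⇔ Z) (pair i))

n*n/4≡⌊n/2⌋*⌈n/2⌉ : ∀ n → (n * n) / 4 ≡ ⌊ n /2⌋ * ⌈ n /2⌉
n*n/4≡⌊n/2⌋*⌈n/2⌉ 0 = refl
n*n/4≡⌊n/2⌋*⌈n/2⌉ 1 = refl
n*n/4≡⌊n/2⌋*⌈n/2⌉ (suc (suc n)) = begin
  (2 + n) * (2 + n) / 4              ≡⟨ /-congˡ (expand n) ⟩
  (n * n + (1 + n) * 4) / 4          ≡⟨ +-distrib-/-∣ʳ (n * n) (divides (1 + n) refl) ⟩
  n * n / 4 + (1 + n) * 4 / 4        ≡⟨ cong₂ _+_ (n*n/4≡⌊n/2⌋*⌈n/2⌉ n) (m*n/n≡m (1 + n) 4) ⟩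
  a * b + (1 + n)                    ≡⟨ cong (λ m → a * b + suc m) (⌊n/2⌋+⌈n/2⌉≡n n) ⟨
  a * b + (1 + (a + b))              ≡⟨ factor a b ⟩
  (1 + a) * (1 + b)                  ∎
  where
  open ≡-Reasoning
  a = ⌊ n /2⌋
  b = ⌈ n /2⌉
  expand : ∀ n → (2 + n) * (2 + n) ≡ n * n + (1 + n) * 4
  expand = solve-∀
  factor : ∀ a b → a * b + (1 + (a + b)) ≡ (1 + a) * (1 + b)
  factor = solve-∀

n*n/4-shattered : ∀ n → Σ (TotalOrderSet n ((n * n) / 4)) Shattered
n*n/4-shattered n =
  subst₂ (λ n k → Σ (TotalOrderSet n k) Shattered) (⌊n/2⌋+⌈n/2⌉≡n n) (sym (n*n/4≡⌊n/2⌋*⌈n/2⌉ n))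
         (flipOrders , flipOrders-shattered)
  where open Bipartite ⌊ n /2⌋ ⌈ n /2⌉

rotation : Fin 3 → BRel 3
rotation i = rankOrder (λ v → (toℕ v + toℕ i) % 3)

rotations : TotalOrderSet 3 3
rotations = record
  { elem     = rotation
  ; total    = from-yes (all? λ i → isTotalOrder? (rotation i))
  ; distinct = from-yes (all? λ i → all? λ j →
                 (all? λ a → all? λ b → rotation i a b ≟ᵇ rotation j a b) →-dec (i ≟ j))
  }

rotationWitness : Vec Bool 3 → BRel 3
rotationWitness (false ∷ false ∷ false ∷ []) a b = rotation 0F b a
rotationWitness (x ∷ y ∷ z ∷ []) a b =
  (not x ∨ rotation 0F a b) ∧ (not y ∨ rotation 1F a b) ∧ (not z ∨ rotation 2F a b)

rotationWitness-correct : ∀ x y z → let v = x ∷ y ∷ z ∷ [] in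
  IsPartialOrder (rotationWitness v) × (∀ i → does (rotationWitness v ⊆ᴿ? rotation i) ≡ lookupᵛ v i)
rotationWitness-correct = from-yes (∀-Bool? λ x → ∀-Bool? λ y → ∀-Bool? λ z → let v = x ∷ y ∷ z ∷ [] in
  isPartialOrder? (rotationWitness v) ×-dec
  (all? λ i → does (rotationWitness v ⊆ᴿ? rotation i) ≟ᵇ lookupᵛ v i))

rotations-shattered : Shattered rotations
rotations-shattered = cut⇒shattered {S = rotations} λ X →
  let v = tabulate X
      (A-po , decided) = rotationWitness-correct (X 0F) (X 1F) (X 2F)
  in rotationWitness v , A-po , λ i → does≡⇒⇔ (_ ⊆ᴿ? _) (trans (decided i) (lookup∘tabulate X i))

lower-bound : ∀ n → Σ (TotalOrderSet n (vcValue n)) Shattered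
lower-bound 3 = rotations , rotations-shattered
lower-bound 0 = n*n/4-shattered 0
lower-bound 1 = n*n/4-shattered 1
lower-bound 2 = n*n/4-shattered 2
lower-bound n@(suc (suc (suc (suc _)))) = n*n/4-shattered n

theorem1 : (n : ℕ) → 1 ≤ n →
    (Σ (TotalOrderSet n (vcValue n)) Shattered) ×
    ((k : ℕ) → (S : TotalOrderSet n k) → Shattered S → k ≤ vcValue n)
theorem1 n 1≤n = lower-bound n , λ k → upper-bound 1≤n
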